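{- Let $n$, $2s$ and $\ell$ be positive integers with $n\ge 2s+1\ge 5$ and $\ell\ge 2$, and let $\delta$ be a positive integer. Then $$N(K_{\ell},G(n,s,t))\ge NM(K_{\ell},\mathcal{F}_1(t))\quad\text{for all integers } t \text{ with } \delta \le t \le s-1,$$ and $$N(K_{\ell},G(n,s,t))\ge NM(K_{\ell},\mathcal{F}_2(t))\quad\text{for all integers } t \text{ with } \delta \le t \le s.$$
   Context: All graphs are finite and simple; $s$ may be an integer or a half-integer. For graphs $H,G$, $N(H,G)$ is the number of subgraphs of $G$ isomorphic to $H$, and for a family $\mathcal{F}$ of graphs $NM(H,\mathcal{F})=\max\{N(H,F):F\in\mathcal{F}\}$. $K_m$ is the complete graph, $\overline{K_m}$ the edgeless graph on $m$ vertices, $+$ disjoint union, $\vee$ join. For an integer $t$ with $\delta\le t\le s$, let $J_t=K_t\vee (K_{2s-2t}+ \overline{K_{n+t-2s}})$, and for a vertex $v$ let $\Gamma(v)$ be the set of edges of $J_t$ incident with $v$. $G(n,s,t)$ is the graph obtained from $J_t$ by deleting $t-\delta$ edges incident to one common vertex $u$ of $\overline{K_{n+t-2s}}$. Further, $\mathcal{F}_1(t)=\{J_t-E_1 : E_1\subseteq \Gamma(v),\ |E_1|=2s-t-1-\delta,\ v\in V(K_{2s-2t})\}$ and $\mathcal{F}_2(t)=\{J_t-E_2 : E_2\subseteq \Gamma(v),\ |E_2|=n-1-\delta,\ v\in V(K_t)\}$. -}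

module Defs where

open import Data.Nat using (ℕ; zero; suc; _+_; _*_; _∸_; _≤_; _<_; _<ᵇ_; _≡ᵇ_)
open import Data.Bool using (Bool; true; false; _∧_; _∨_; not; if_then_else_)
open import Data.Fin using (Fin; toℕ; _≟_)
open import Data.Fin.Subset using (Subset; ∣_∣)
open import Data.Vec using (Vec; []; _∷_; lookup; tabulate)
open import Data.List.Base using (List; []; _∷_; map; _++_; length; filterᵇ; allFin; foldr)
open import Data.Product using (_×_)
open import Relation.Nullary.Decidable using (⌊_⌋)

-- A (finite simple) graph on vertex set Fin n, given by its Boolean
-- adjacency relation.  All graphs built below are symmetric and loopless.
Graph : ℕ → Set
Graph n = Fin n → Fin n → Bool

_==_ : {n : ℕ} → Fin n → Fin n → Bool
i == j = ⌊ i ≟ j ⌋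

allSubsets : (n : ℕ) → List (Subset n)
allSubsets zero    = [] ∷ []
allSubsets (suc n) = map (true ∷_) (allSubsets n) ++ map (false ∷_) (allSubsets n)

allᵇ : {A : Set} → (A → Bool) → List A → Bool
allᵇ p = foldr (λ x b → p x ∧ b) true

isClique : {n : ℕ} → Graph n → Subset n → Bool
isClique {n} G S =
  allᵇ (λ i → allᵇ (λ j → not (lookup S i ∧ lookup S j ∧ not (i == j)) ∨ G i j)
                 (allFin n))
      (allFin n)

-- N(K_ℓ, G): number of subgraphs of G isomorphic to K_ℓ, i.e. the number
-- of ℓ-element vertex sets of G that are cliques.
NK : {n : ℕ} → ℕ → Graph n → ℕ
NK {n} ℓ G = length (filterᵇ (λ S → (∣ S ∣ ≡ᵇ ℓ) ∧ isClique G S) (allSubsets n))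

nbhd : {n : ℕ} → Graph n → Fin n → Subset n
nbhd G v = tabulate (G v)

-- G minus the edges { v w : w ∈ W } (a set of edges incident with v,
-- encoded by the set W of their other endpoints).
delAt : {n : ℕ} → Graph n → Fin n → Subset n → Graph n
delAt G v W i j =
  G i j ∧ not (((i == v) ∧ lookup W j) ∨ ((j == v) ∧ lookup W i))

-- Here m = 2s (s an integer or half-integer).  Vertex layout of J_t on Fin n:
--   K_t                      : toℕ v < t
--   K_{2s-2t}                : t ≤ toℕ v < 2s - t
--   independent set of size n+t-2s : 2s - t ≤ toℕ v
-- J_t = K_t ∨ (K_{2s-2t} + \overline{K_{n+t-2s}})
J : {n : ℕ} → (m t : ℕ) → Graph n
J m t i j =
  not (i == j) ∧
  ((toℕ i <ᵇ t) ∨ (toℕ j <ᵇ t) ∨ ((toℕ i <ᵇ (m ∸ t)) ∧ (toℕ j <ᵇ (m ∸ t))))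

InKt : {n : ℕ} → ℕ → Fin n → Set
InKt t v = toℕ v < t

InKmid : {n : ℕ} → (m t : ℕ) → Fin n → Set
InKmid m t v = (t ≤ toℕ v) × (toℕ v < m ∸ t)

InIndep : {n : ℕ} → (m t : ℕ) → Fin n → Set
InIndep m t v = m ∸ t ≤ toℕ v

module Submission where

-- Write G₁ = J_t − vW and G₂ = J_t − uU and split the ℓ-cliques of each graph
-- according to whether they contain v (resp. u).
--
-- Every neighbour of u lies in K_t, and v is adjacent to all of K_t, so the
-- transposition (u v) maps G₁ − v into G₂ − u; relabelling by it is an injection
-- from the ℓ-cliques of G₁ avoiding v into those of G₂ avoiding u.
--
-- An ℓ-clique of G₁ through v is an ℓ-subset of {v} ∪ N_{G₁}(v) containing v, and
-- |N_{G₁}(v)| ≤ δ because only δ edges at v survive the deletion.  Conversely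
-- K_t − U has at least δ vertices, is a clique, and is joined to u in G₂, so every
-- ℓ-subset of {u} ∪ (K_t − U) containing u is an ℓ-clique of G₂.  Counting the
-- ℓ-subsets through a fixed point of a set of size a + 1 gives (a choose ℓ − 1),
-- which is monotone in a.

open import Defs
open import Data.Bool using (Bool; true; false; _∧_; _∨_; not; T)
open import Data.Bool.Properties using (T-≡; T-∧; T-∨; T?; ∧-zeroʳ)
open import Data.Empty using (⊥-elim)
open import Data.Fin using (Fin; zero; suc; toℕ; _≟_)
open import Data.Fin.Permutation as Perm using (Permutation′; _⟨$⟩ʳ_; _⟨$⟩ˡ_; inverseˡ; inverseʳ)
open import Data.Fin.Properties using (toℕ<n)
open import Data.Fin.Subset
  using (Subset; inside; outside; ∣_∣; _∈_; _∉_; _⊆_; _∩_; _∪_; _─_; _-_; ⁅_⁆)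
open import Data.Fin.Subset.Properties
  using (_⊆?_; p─⊥≡p; p─q⊆p; x∈p∧x≢y⇒x∈p-y; x∈p∧x∉q⇒x∈p─q; x∈⁅x⁆; x∈⁅y⁆⇒x≡y;
         x∈p∪q⁺; x∈p∪q⁻; x∈p∩q⁺; p⊆q⇒∣p∣≤∣q∣; x∈p⇒∣p-x∣<∣p∣; ∣p∩q∣≤∣q∣)
open import Data.List.Base using (List; []; _∷_; map; _++_; length; filterᵇ; allFin; tabulate)
open import Data.List.Membership.Propositional using () renaming (_∈_ to _∈ₗ_)
open import Data.List.Membership.Propositional.Properties
  using (∈-++⁺ˡ; ∈-++⁺ʳ; ∈-++⁻; ∈-map⁺; ∈-map⁻; ∈-∃++; ∈-filter⁺; ∈-filter⁻; ∈-allFin)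
open import Data.List.Properties using (length-++; length-map)
open import Data.List.Relation.Unary.All as All using ([])
open import Data.List.Relation.Unary.AllPairs using ([]; _∷_)
open import Data.List.Relation.Unary.Any using (here; there)
open import Data.List.Relation.Unary.Unique.Propositional using (Unique)
import Data.List.Relation.Unary.Unique.Propositional.Properties as Unique
open import Data.Nat
  using (ℕ; zero; suc; _+_; _*_; _∸_; _≤_; _<_; _<ᵇ_; _≡ᵇ_; _≤′_; ≤′-reflexive; ≤′-step; z≤n; s≤s)
open import Data.Nat.Combinatorics using (_C_; nCk≡nC[n∸k]; nCn≡1; nCk+nC[k+1]≡[n+1]C[k+1])
open import Data.Nat.Properties
  using (≡ᵇ⇒≡; ≡⇒≡ᵇ; <ᵇ⇒<; <⇒<ᵇ; ≤-refl; ≤-reflexive; ≤-trans; ≤-antisym; ≤-<-trans; <-≤-trans;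
         <⇒≱; ≤⇒≤′; +-comm; +-suc; +-identityʳ; +-cancelʳ-≡; +-mono-≤; +-monoˡ-≤; m≤n+m; m≤m+n;
         m∸n≤m; m≤n+m∸n; m∸[m∸n]≡n; m+n≤o⇒m≤o∸n; m≤n+o⇒m∸n≤o; module ≤-Reasoning)
open import Data.Product using (_×_; _,_; proj₁; proj₂)
open import Data.Product.Function.NonDependent.Propositional using (_×-⇔_)
open import Data.Sum using (_⊎_; inj₁; inj₂)
open import Data.Sum.Function.Propositional using (_⊎-⇔_)
open import Data.Vec using ([]; _∷_; lookup; here; there)
import Data.Vec as Vec
open import Data.Vec.Properties
  using (∷-injective; lookup∘tabulate; tabulate∘lookup; tabulate-cong; lookup⇒[]=; []=⇒lookup)
open import Function using (_∘_; id; Injective)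
open import Function.Bundles using (Equivalence; _⇔_; mk⇔)
open import Function.Construct.Composition using (_⇔-∘_)
open import Relation.Binary.PropositionalEquality hiding (J)
open import Relation.Nullary using (¬_; Dec; does; _because_; yes; no)
open import Relation.Nullary.Decidable using (dec-true; dec-false; toWitness; fromWitness)
open import Relation.Nullary.Reflects using (invert)

open Equivalence using (to; from)

private
  variable
    A B : Set
    n : ℕ

m+[n∸o]≤n⇒m≤o : ∀ m n o → m + (n ∸ o) ≤ n → m ≤ o
m+[n∸o]≤n⇒m≤o m n o le = ≤-trans (m+n≤o⇒m≤o∸n m le)
  (m≤n+o⇒m∸n≤o n (n ∸ o) (subst (n ≤_) (+-comm o (n ∸ o)) (m≤n+m∸n n o)))

n≤[n∸o]+m⇒o≤m : ∀ {m n o} → o ≤ n → n ≤ (n ∸ o) + m → o ≤ m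
n≤[n∸o]+m⇒o≤m {m} {n} {o} o≤n le = subst (_≤ m) (m∸[m∸n]≡n o≤n) (m≤n+o⇒m∸n≤o n (n ∸ o) le)

T-⇔⇒≡ : {a b : Bool} → (T a → T b) → (T b → T a) → a ≡ b
T-⇔⇒≡ {false} {false} _   _   = refl
T-⇔⇒≡ {false} {true}  _   b⇒a = ⊥-elim (b⇒a _)
T-⇔⇒≡ {true}  {false} a⇒b _   = ⊥-elim (a⇒b _)
T-⇔⇒≡ {true}  {true}  _   _   = refl

T-not⇔¬T : {b : Bool} → T (not b) ⇔ (¬ T b)
T-not⇔¬T {false} = mk⇔ (λ _ ()) (λ _ → _)
T-not⇔¬T {true}  = mk⇔ (λ ()) (λ ¬t → ¬t _)

T-does⇔ : {P : Set} (P? : Dec P) → T (does P?) ⇔ P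
T-does⇔ {P} P? = mk⇔ (does⇒ P?) (λ p → from T-≡ (dec-true P? p))
  where
  does⇒ : (P? : Dec P) → T (does P?) → P
  does⇒ (true because [p]) _ = invert [p]

T-≡ᵇ⇔ : {m k : ℕ} → T (m ≡ᵇ k) ⇔ m ≡ k
T-≡ᵇ⇔ {m} {k} = mk⇔ (≡ᵇ⇒≡ m k) (≡⇒≡ᵇ m k)

T-<ᵇ⇔ : {m k : ℕ} → T (m <ᵇ k) ⇔ m < k
T-<ᵇ⇔ {m} {k} = mk⇔ (<ᵇ⇒< m k) <⇒<ᵇ

T-==⇔ : {i j : Fin n} → T (i == j) ⇔ i ≡ j
T-==⇔ = mk⇔ toWitness fromWitness

T-allᵇ⇔ : (p : A → Bool) (xs : List A) → T (allᵇ p xs) ⇔ (∀ {x} → x ∈ₗ xs → T (p x))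
T-allᵇ⇔ p xs = mk⇔ (allᵇ⁻ xs) (allᵇ⁺ xs)
  where
  allᵇ⁻ : ∀ xs → T (allᵇ p xs) → ∀ {x} → x ∈ₗ xs → T (p x)
  allᵇ⁻ (y ∷ ys) t (here refl)  = proj₁ (to T-∧ t)
  allᵇ⁻ (y ∷ ys) t (there x∈ys) = allᵇ⁻ ys (proj₂ (to T-∧ t)) x∈ys
  allᵇ⁺ : ∀ xs → (∀ {x} → x ∈ₗ xs → T (p x)) → T (allᵇ p xs)
  allᵇ⁺ []       _  = _
  allᵇ⁺ (y ∷ ys) px = from T-∧ (px (here refl) , allᵇ⁺ ys (px ∘ there))

length-filterᵇ-partition : (p r : A → Bool) (xs : List A) →
  length (filterᵇ p xs) ≡
  length (filterᵇ (λ x → p x ∧ r x) xs) + length (filterᵇ (λ x → p x ∧ not (r x)) xs)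
length-filterᵇ-partition p r [] = refl
length-filterᵇ-partition p r (x ∷ xs) with p x | r x
... | true  | true  = cong suc (length-filterᵇ-partition p r xs)
... | true  | false = trans (cong suc (length-filterᵇ-partition p r xs)) (sym (+-suc _ _))
... | false | _     = length-filterᵇ-partition p r xs

length-filterᵇ-++ : (p : A → Bool) (xs ys : List A) →
  length (filterᵇ p (xs ++ ys)) ≡ length (filterᵇ p xs) + length (filterᵇ p ys)
length-filterᵇ-++ p [] ys = refl
length-filterᵇ-++ p (x ∷ xs) ys with p x
... | true  = cong suc (length-filterᵇ-++ p xs ys)
... | false = length-filterᵇ-++ p xs ys

length-filterᵇ-map : (p : B → Bool) (f : A → B) (xs : List A) →
  length (filterᵇ p (map f xs)) ≡ length (filterᵇ (p ∘ f) xs)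
length-filterᵇ-map p f [] = refl
length-filterᵇ-map p f (x ∷ xs) with p (f x)
... | true  = cong suc (length-filterᵇ-map p f xs)
... | false = length-filterᵇ-map p f xs

length-filterᵇ-false : (xs : List A) → length (filterᵇ (λ _ → false) xs) ≡ 0
length-filterᵇ-false []       = refl
length-filterᵇ-false (_ ∷ xs) = length-filterᵇ-false xs

length-filterᵇ-cong : {p q : A → Bool} → (∀ x → p x ≡ q x) → (xs : List A) →
  length (filterᵇ p xs) ≡ length (filterᵇ q xs)
length-filterᵇ-cong p≗q [] = refl
length-filterᵇ-cong {q = q} p≗q (x ∷ xs) rewrite p≗q x with q x
... | true  = cong suc (length-filterᵇ-cong p≗q xs)
... | false = length-filterᵇ-cong p≗q xs

Unique-length-≤ : {xs ys : List A} → Unique xs → (∀ {x} → x ∈ₗ xs → x ∈ₗ ys) →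
  length xs ≤ length ys
Unique-length-≤ {xs = []} _ _ = z≤n
Unique-length-≤ {xs = x ∷ xs} (x∉xs ∷ xs-unique) xs⊆ys with ∈-∃++ (xs⊆ys (here refl))
... | ys₁ , ys₂ , refl = begin
  suc (length xs)                ≤⟨ s≤s (Unique-length-≤ xs-unique xs⊆ys₁++ys₂) ⟩
  suc (length (ys₁ ++ ys₂))      ≡⟨ cong suc (length-++ ys₁) ⟩
  suc (length ys₁ + length ys₂)  ≡⟨ +-suc (length ys₁) _ ⟨
  length ys₁ + length (x ∷ ys₂)  ≡⟨ length-++ ys₁ ⟨
  length (ys₁ ++ x ∷ ys₂)        ∎
  where
  open ≤-Reasoning
  xs⊆ys₁++ys₂ : ∀ {y} → y ∈ₗ xs → y ∈ₗ ys₁ ++ ys₂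
  xs⊆ys₁++ys₂ y∈xs with ∈-++⁻ ys₁ (xs⊆ys (there y∈xs))
  ... | inj₁ y∈ys₁         = ∈-++⁺ˡ y∈ys₁
  ... | inj₂ (here refl)   = ⊥-elim (All.lookup x∉xs y∈xs refl)
  ... | inj₂ (there y∈ys₂) = ∈-++⁺ʳ ys₁ y∈ys₂

length-filterᵇ-injection : {xs : List A} → Unique xs → (∀ x → x ∈ₗ xs) →
  {p q : A → Bool} (σ : A → A) → Injective _≡_ _≡_ σ → (∀ x → T (p x) → T (q (σ x))) →
  length (filterᵇ p xs) ≤ length (filterᵇ q xs)
length-filterᵇ-injection {xs = xs} xs-unique xs-complete {p} {q} σ σ-injective p⇒q∘σ =
  subst (_≤ length (filterᵇ q xs)) (length-map σ (filterᵇ p xs))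
    (Unique-length-≤ (Unique.map⁺ σ-injective (Unique.filter⁺ (T? ∘ p) {xs = xs} xs-unique)) image⊆)
  where
  image⊆ : ∀ {y} → y ∈ₗ map σ (filterᵇ p xs) → y ∈ₗ filterᵇ q xs
  image⊆ y∈ with ∈-map⁻ σ y∈
  ... | x , x∈ , refl =
    ∈-filter⁺ (T? ∘ q) (xs-complete (σ x)) (p⇒q∘σ x (proj₂ (∈-filter⁻ (T? ∘ p) {xs = xs} x∈)))

T-lookup⇔∈ : {S : Subset n} {i : Fin n} → T (lookup S i) ⇔ i ∈ S
T-lookup⇔∈ {S = S} {i} = mk⇔ (lookup⇒[]= i S ∘ to T-≡) (from T-≡ ∘ []=⇒lookup)

∈-tabulate⇔ : {f : Fin n → Bool} {i : Fin n} → i ∈ Vec.tabulate f ⇔ T (f i)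
∈-tabulate⇔ {f = f} {i} = mk⇔
  (subst T (lookup∘tabulate f i) ∘ from T-lookup⇔∈)
  (to T-lookup⇔∈ ∘ subst T (sym (lookup∘tabulate f i)))

x∈p─q⇒x∉q : {x : Fin n} {p q : Subset n} → x ∈ p ─ q → x ∉ q
x∈p─q⇒x∉q {p = inside ∷ _} {outside ∷ _} here       ()
x∈p─q⇒x∉q {p = _ ∷ _}      {_ ∷ _}       (there x∈) (there x∈q) = x∈p─q⇒x∉q x∈ x∈q

x∉p-x : {x : Fin n} (p : Subset n) → x ∉ p - x
x∉p-x {x = x} p x∈p-x = x∈p─q⇒x∉q x∈p-x (x∈⁅x⁆ x)

⊆p-x⇔ : {S p : Subset n} {x : Fin n} → S ⊆ p - x ⇔ (S ⊆ p × x ∉ S)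
⊆p-x⇔ {p = p} = mk⇔
  (λ S⊆p-x → (λ {y} y∈S → p─q⊆p p _ (S⊆p-x y∈S)) , (λ x∈S → x∉p-x p (S⊆p-x x∈S)))
  (λ (S⊆p , x∉S) {y} y∈S → x∈p∧x≢y⇒x∈p-y (S⊆p y∈S) (λ { refl → x∉S y∈S }))

[⁅x⁆∪p]-x⊆p : {x : Fin n} {p : Subset n} → (⁅ x ⁆ ∪ p) - x ⊆ p
[⁅x⁆∪p]-x⊆p {x = x} {p} y∈ with x∈p∪q⁻ ⁅ x ⁆ p (p─q⊆p (⁅ x ⁆ ∪ p) ⁅ x ⁆ y∈)
... | inj₁ y∈⁅x⁆ = ⊥-elim (x∈p─q⇒x∉q y∈ y∈⁅x⁆)
... | inj₂ y∈p   = y∈p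

x∉p⇒p⊆[⁅x⁆∪p]-x : {x : Fin n} {p : Subset n} → x ∉ p → p ⊆ (⁅ x ⁆ ∪ p) - x
x∉p⇒p⊆[⁅x⁆∪p]-x x∉p y∈p = x∈p∧x≢y⇒x∈p-y (x∈p∪q⁺ (inj₂ y∈p)) (λ { refl → x∉p y∈p })

∣p∣≡∣p∩q∣+∣p─q∣ : (p q : Subset n) → ∣ p ∣ ≡ ∣ p ∩ q ∣ + ∣ p ─ q ∣
∣p∣≡∣p∩q∣+∣p─q∣ []            []            = refl
∣p∣≡∣p∩q∣+∣p─q∣ (inside ∷ p)  (inside ∷ q)  = cong suc (∣p∣≡∣p∩q∣+∣p─q∣ p q)
∣p∣≡∣p∩q∣+∣p─q∣ (inside ∷ p)  (outside ∷ q) =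
  trans (cong suc (∣p∣≡∣p∩q∣+∣p─q∣ p q)) (sym (+-suc ∣ p ∩ q ∣ ∣ p ─ q ∣))
∣p∣≡∣p∩q∣+∣p─q∣ (outside ∷ p) (inside ∷ q)  = ∣p∣≡∣p∩q∣+∣p─q∣ p q
∣p∣≡∣p∩q∣+∣p─q∣ (outside ∷ p) (outside ∷ q) = ∣p∣≡∣p∩q∣+∣p─q∣ p q

∣p∣≤∣q∣+∣p─q∣ : (p q : Subset n) → ∣ p ∣ ≤ ∣ q ∣ + ∣ p ─ q ∣
∣p∣≤∣q∣+∣p─q∣ p q = ≤-trans (≤-reflexive (∣p∣≡∣p∩q∣+∣p─q∣ p q)) (+-monoˡ-≤ _ (∣p∩q∣≤∣q∣ p q))

q⊆p⇒∣p─q∣+∣q∣≤∣p∣ : {p q : Subset n} → q ⊆ p → ∣ p ─ q ∣ + ∣ q ∣ ≤ ∣ p ∣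
q⊆p⇒∣p─q∣+∣q∣≤∣p∣ {p = p} {q} q⊆p = begin
  ∣ p ─ q ∣ + ∣ q ∣      ≡⟨ +-comm ∣ p ─ q ∣ ∣ q ∣ ⟩
  ∣ q ∣ + ∣ p ─ q ∣      ≤⟨ +-monoˡ-≤ _ (p⊆q⇒∣p∣≤∣q∣ (λ x∈q → x∈p∩q⁺ (q⊆p x∈q , x∈q))) ⟩
  ∣ p ∩ q ∣ + ∣ p ─ q ∣  ≡⟨ ∣p∣≡∣p∩q∣+∣p─q∣ p q ⟨
  ∣ p ∣                  ∎
  where open ≤-Reasoning

∣q∣≡∣p∣∸d⇒d≤∣p─q∣ : {p q : Subset n} {d : ℕ} → d ≤ ∣ p ∣ → ∣ q ∣ ≡ ∣ p ∣ ∸ d → d ≤ ∣ p ─ q ∣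
∣q∣≡∣p∣∸d⇒d≤∣p─q∣ {p = p} {q} d≤∣p∣ ∣q∣≡∣p∣∸d =
  n≤[n∸o]+m⇒o≤m d≤∣p∣ (subst (λ x → ∣ p ∣ ≤ x + ∣ p ─ q ∣) ∣q∣≡∣p∣∸d (∣p∣≤∣q∣+∣p─q∣ p q))

∣p∣≡1+∣p-x∣ : {x : Fin n} {p : Subset n} → x ∈ p → ∣ p ∣ ≡ suc ∣ p - x ∣
∣p∣≡1+∣p-x∣ {p = inside ∷ p}  here        = cong (suc ∘ ∣_∣) (sym (p─⊥≡p p))
∣p∣≡1+∣p-x∣ {p = inside ∷ p}  (there x∈p) = cong suc (∣p∣≡1+∣p-x∣ x∈p)
∣p∣≡1+∣p-x∣ {p = outside ∷ p} (there x∈p) = ∣p∣≡1+∣p-x∣ x∈p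

length-filterᵇ-tabulate : (p : A → Bool) (g : Fin n → A) →
  length (filterᵇ p (tabulate g)) ≡ ∣ Vec.tabulate (p ∘ g) ∣
length-filterᵇ-tabulate {n = zero}  p g = refl
length-filterᵇ-tabulate {n = suc n} p g with p (g zero)
... | true  = cong suc (length-filterᵇ-tabulate p (g ∘ suc))
... | false = length-filterᵇ-tabulate p (g ∘ suc)

∣tabulate∣-injection : {f g : Fin n → Bool} (ρ : Fin n → Fin n) → Injective _≡_ _≡_ ρ →
  (∀ i → T (f i) → T (g (ρ i))) → ∣ Vec.tabulate f ∣ ≤ ∣ Vec.tabulate g ∣
∣tabulate∣-injection {n} {f} {g} ρ ρ-injective f⇒g∘ρ = subst₂ _≤_
  (length-filterᵇ-tabulate f id) (length-filterᵇ-tabulate g id)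
  (length-filterᵇ-injection (Unique.allFin⁺ n) ∈-allFin ρ ρ-injective f⇒g∘ρ)

-- `below t` is the vertex set of K_t, the first t vertices.
below : ℕ → Subset n
below b = Vec.tabulate (λ k → toℕ k <ᵇ b)

∈-below⇔ : {b : ℕ} {k : Fin n} → k ∈ below b ⇔ toℕ k < b
∈-below⇔ = T-<ᵇ⇔ ⇔-∘ ∈-tabulate⇔

∣below∣ : {b : ℕ} → b ≤ n → ∣ below {n} b ∣ ≡ b
∣below∣ {zero}  {zero}  _         = refl
∣below∣ {suc n} {zero}  _         = ∣below∣ {n} z≤n
∣below∣ {suc n} {suc b} (s≤s b≤n) = cong suc (∣below∣ b≤n)

⟨$⟩ʳ-injective : (π : Permutation′ n) → Injective _≡_ _≡_ (π ⟨$⟩ʳ_)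
⟨$⟩ʳ-injective π eq = trans (sym (inverseˡ π)) (trans (cong (π ⟨$⟩ˡ_) eq) (inverseˡ π))

relabel : Permutation′ n → Subset n → Subset n
relabel π S = Vec.tabulate (λ i → lookup S (π ⟨$⟩ˡ i))

∈-relabel⇔ : (π : Permutation′ n) {S : Subset n} {i : Fin n} → i ∈ relabel π S ⇔ π ⟨$⟩ˡ i ∈ S
∈-relabel⇔ π = T-lookup⇔∈ ⇔-∘ ∈-tabulate⇔

relabel-injective : (π : Permutation′ n) → Injective _≡_ _≡_ (relabel π)
relabel-injective π {S} {S′} eq = begin
  S                         ≡⟨ tabulate∘lookup S ⟨
  Vec.tabulate (lookup S)   ≡⟨ tabulate-cong lookup-S≗S′ ⟩
  Vec.tabulate (lookup S′)  ≡⟨ tabulate∘lookup S′ ⟩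
  S′                        ∎
  where
  open ≡-Reasoning
  lookup-relabel : ∀ R i → lookup (relabel π R) (π ⟨$⟩ʳ i) ≡ lookup R i
  lookup-relabel R i = trans (lookup∘tabulate _ (π ⟨$⟩ʳ i)) (cong (lookup R) (inverseˡ π))
  lookup-S≗S′ : ∀ i → lookup S i ≡ lookup S′ i
  lookup-S≗S′ i = begin
    lookup S i                        ≡⟨ lookup-relabel S i ⟨
    lookup (relabel π S) (π ⟨$⟩ʳ i)   ≡⟨ cong (λ R → lookup R (π ⟨$⟩ʳ i)) eq ⟩
    lookup (relabel π S′) (π ⟨$⟩ʳ i)  ≡⟨ lookup-relabel S′ i ⟩
    lookup S′ i                       ∎

∣relabel∣ : (π : Permutation′ n) (S : Subset n) → ∣ relabel π S ∣ ≡ ∣ S ∣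
∣relabel∣ π S = ≤-antisym
  (subst (∣ relabel π S ∣ ≤_) (cong ∣_∣ (tabulate∘lookup S))
    (∣tabulate∣-injection (π ⟨$⟩ˡ_) (⟨$⟩ʳ-injective (Perm.flip π)) (λ _ t → t)))
  (subst (_≤ ∣ relabel π S ∣) (cong ∣_∣ (tabulate∘lookup S))
    (∣tabulate∣-injection (π ⟨$⟩ʳ_) (⟨$⟩ʳ-injective π)
      (λ i → subst T (cong (lookup S) (sym (inverseˡ π))))))

module _ (i j : Fin n) where

  transpose-matchˡ : Perm.transpose i j ⟨$⟩ʳ i ≡ j
  transpose-matchˡ rewrite dec-true (i ≟ i) refl = refl

  transpose-matchʳ : Perm.transpose i j ⟨$⟩ʳ j ≡ i
  transpose-matchʳ with j ≟ i
  ... | yes j≡i = j≡i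
  ... | no _ rewrite dec-true (j ≟ j) refl = refl

  transpose-other : {k : Fin n} → k ≢ i → k ≢ j → Perm.transpose i j ⟨$⟩ʳ k ≡ k
  transpose-other {k} k≢i k≢j rewrite dec-false (k ≟ i) k≢i | dec-false (k ≟ j) k≢j = refl

-- Counting subsets of Fin n

allSubsets-complete : (S : Subset n) → S ∈ₗ allSubsets n
allSubsets-complete []                    = here refl
allSubsets-complete (inside ∷ S)          = ∈-++⁺ˡ (∈-map⁺ (inside ∷_) (allSubsets-complete S))
allSubsets-complete {suc n} (outside ∷ S) =
  ∈-++⁺ʳ (map (inside ∷_) (allSubsets n)) (∈-map⁺ (outside ∷_) (allSubsets-complete S))

allSubsets-unique : (n : ℕ) → Unique (allSubsets n)
allSubsets-unique zero    = [] ∷ []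
allSubsets-unique (suc n) =
  Unique.++⁺ (Unique.map⁺ ∷-injectiveʳ (allSubsets-unique n))
             (Unique.map⁺ ∷-injectiveʳ (allSubsets-unique n))
             disjoint
  where
  ∷-injectiveʳ : ∀ {s : Bool} {S S′ : Subset n} → s ∷ S ≡ s ∷ S′ → S ≡ S′
  ∷-injectiveʳ = proj₂ ∘ ∷-injective
  disjoint : ∀ {S} → ¬ (S ∈ₗ map (inside ∷_) (allSubsets n) × S ∈ₗ map (outside ∷_) (allSubsets n))
  disjoint (S∈ , S∈′) with ∈-map⁻ (inside ∷_) S∈ | ∈-map⁻ (outside ∷_) S∈′
  ... | _ , _ , refl | _ , _ , ()

countSubsets : (Subset n → Bool) → ℕ
countSubsets {n} p = length (filterᵇ p (allSubsets n))

countSubsets-cons : (p : Subset (suc n) → Bool) →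
  countSubsets p ≡ countSubsets (p ∘ (inside ∷_)) + countSubsets (p ∘ (outside ∷_))
countSubsets-cons {n} p = begin
  length (filterᵇ p (map (inside ∷_) (allSubsets n) ++ map (outside ∷_) (allSubsets n)))
    ≡⟨ length-filterᵇ-++ p (map (inside ∷_) (allSubsets n)) _ ⟩
  length (filterᵇ p (map (inside ∷_) (allSubsets n))) +
  length (filterᵇ p (map (outside ∷_) (allSubsets n)))
    ≡⟨ cong₂ _+_ (length-filterᵇ-map p _ (allSubsets n)) (length-filterᵇ-map p _ (allSubsets n)) ⟩
  countSubsets (p ∘ (inside ∷_)) + countSubsets (p ∘ (outside ∷_)) ∎
  where open ≡-Reasoning

countSubsets-false : countSubsets {n} (λ _ → false) ≡ 0
countSubsets-false {n} = length-filterᵇ-false (allSubsets n)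

countSubsets-cong : {p q : Subset n → Bool} → (∀ S → p S ≡ q S) → countSubsets p ≡ countSubsets q
countSubsets-cong {n} p≗q = length-filterᵇ-cong p≗q (allSubsets n)

countSubsets-partition : (p r : Subset n → Bool) →
  countSubsets p ≡ countSubsets (λ S → p S ∧ r S) + countSubsets (λ S → p S ∧ not (r S))
countSubsets-partition {n} p r = length-filterᵇ-partition p r (allSubsets n)

countSubsets-injection : {p q : Subset n → Bool} (σ : Subset n → Subset n) →
  Injective _≡_ _≡_ σ → (∀ S → T (p S) → T (q (σ S))) → countSubsets p ≤ countSubsets q
countSubsets-injection {n} = length-filterᵇ-injection (allSubsets-unique n) allSubsets-complete

countSubsets-mono : {p q : Subset n → Bool} → (∀ S → T (p S) → T (q S)) →
  countSubsets p ≤ countSubsets q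
countSubsets-mono = countSubsets-injection id id

nC0≡1 : ∀ n → n C 0 ≡ 1
nC0≡1 n = trans (nCk≡nC[n∸k] {0} {n} z≤n) (nCn≡1 n)

nCk≤[1+n]Ck : ∀ n k → n C k ≤ suc n C k
nCk≤[1+n]Ck n zero    = ≤-reflexive (trans (nC0≡1 n) (sym (nC0≡1 (suc n))))
nCk≤[1+n]Ck n (suc k) = subst (n C suc k ≤_) (nCk+nC[k+1]≡[n+1]C[k+1] n k) (m≤n+m _ _)

C-monoˡ-≤ : ∀ {a b} k → a ≤ b → a C k ≤ b C k
C-monoˡ-≤ {a} k a≤b = go (≤⇒≤′ a≤b)
  where
  go : ∀ {b} → a ≤′ b → a C k ≤ b C k
  go (≤′-reflexive refl) = ≤-refl
  go (≤′-step a≤′b)      = ≤-trans (go a≤′b) (nCk≤[1+n]Ck _ k)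

-- `does` rather than `⌊_⌋`, so that `S ⊆? X` unfolds definitionally on cons cells.
sizedSubsetOf : Subset n → ℕ → Subset n → Bool
sizedSubsetOf X k S = does (S ⊆? X) ∧ (∣ S ∣ ≡ᵇ k)

T-sizedSubsetOf⇔ : (X : Subset n) (k : ℕ) (S : Subset n) →
  T (sizedSubsetOf X k S) ⇔ (S ⊆ X × ∣ S ∣ ≡ k)
T-sizedSubsetOf⇔ X k S = (T-does⇔ (S ⊆? X) ×-⇔ T-≡ᵇ⇔) ⇔-∘ T-∧

countSubsets-sizedSubsetOf : (X : Subset n) (k : ℕ) → countSubsets (sizedSubsetOf X k) ≡ ∣ X ∣ C k
countSubsets-sizedSubsetOf [] zero    = refl
countSubsets-sizedSubsetOf [] (suc k) = refl
countSubsets-sizedSubsetOf {suc n} (x ∷ X) k =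
  trans (countSubsets-cons (sizedSubsetOf (x ∷ X) k)) (split x k)
  where
  split : ∀ x k → countSubsets (sizedSubsetOf (x ∷ X) k ∘ (inside ∷_))
                    + countSubsets (sizedSubsetOf X k) ≡ ∣ x ∷ X ∣ C k
  split outside k =
    trans (cong (_+ countSubsets (sizedSubsetOf X k)) (countSubsets-false {n}))
          (countSubsets-sizedSubsetOf X k)
  split inside zero = begin
    countSubsets (λ S → does (S ⊆? X) ∧ false) + countSubsets (sizedSubsetOf X 0)
      ≡⟨ cong₂ _+_
           (trans (countSubsets-cong (λ S → ∧-zeroʳ (does (S ⊆? X)))) (countSubsets-false {n}))
           (countSubsets-sizedSubsetOf X 0) ⟩
    ∣ X ∣ C 0      ≡⟨ trans (nC0≡1 ∣ X ∣) (sym (nC0≡1 (suc ∣ X ∣))) ⟩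
    suc ∣ X ∣ C 0  ∎
    where open ≡-Reasoning
  split inside (suc k) =
    trans (cong₂ _+_ (countSubsets-sizedSubsetOf X k) (countSubsets-sizedSubsetOf X (suc k)))
          (nCk+nC[k+1]≡[n+1]C[k+1] ∣ X ∣ k)

sizedSubsetOf-avoiding : (X : Subset n) (k : ℕ) (z : Fin n) (S : Subset n) →
  sizedSubsetOf X k S ∧ not (lookup S z) ≡ sizedSubsetOf (X - z) k S
sizedSubsetOf-avoiding X k z S = T-⇔⇒≡ avoiding⇒ avoiding⇐
  where
  avoiding⇒ : T (sizedSubsetOf X k S ∧ not (lookup S z)) → T (sizedSubsetOf (X - z) k S)
  avoiding⇒ t with to T-∧ t
  ... | t₁ , z∉S with to (T-sizedSubsetOf⇔ X k S) t₁
  ... | S⊆X , ∣S∣≡k = from (T-sizedSubsetOf⇔ (X - z) k S)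
    (from ⊆p-x⇔ (S⊆X , to T-not⇔¬T z∉S ∘ from T-lookup⇔∈) , ∣S∣≡k)
  avoiding⇐ : T (sizedSubsetOf (X - z) k S) → T (sizedSubsetOf X k S ∧ not (lookup S z))
  avoiding⇐ t with to (T-sizedSubsetOf⇔ (X - z) k S) t
  ... | S⊆X-z , ∣S∣≡k with to ⊆p-x⇔ S⊆X-z
  ... | S⊆X , z∉S = from T-∧
    (from (T-sizedSubsetOf⇔ X k S) (S⊆X , ∣S∣≡k) , from T-not⇔¬T (z∉S ∘ to T-lookup⇔∈))

module _ {X : Subset n} {z : Fin n} (z∈X : z ∈ X) where

  countSubsets-through : (k : ℕ) →
    countSubsets (λ S → sizedSubsetOf X k S ∧ lookup S z) + ∣ X - z ∣ C k ≡ suc ∣ X - z ∣ C k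
  countSubsets-through k = begin
    through + ∣ X - z ∣ C k
      ≡⟨ cong (through +_) (countSubsets-sizedSubsetOf (X - z) k) ⟨
    through + countSubsets (sizedSubsetOf (X - z) k)
      ≡⟨ cong (through +_) (countSubsets-cong (sizedSubsetOf-avoiding X k z)) ⟨
    through + countSubsets (λ S → sizedSubsetOf X k S ∧ not (lookup S z))
      ≡⟨ countSubsets-partition (sizedSubsetOf X k) (λ S → lookup S z) ⟨
    countSubsets (sizedSubsetOf X k)
      ≡⟨ countSubsets-sizedSubsetOf X k ⟩
    ∣ X ∣ C k
      ≡⟨ cong (_C k) (∣p∣≡1+∣p-x∣ z∈X) ⟩
    suc ∣ X - z ∣ C k ∎
    where
    open ≡-Reasoning
    through : ℕ
    through = countSubsets (λ S → sizedSubsetOf X k S ∧ lookup S z)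

  countSubsets-through-zero : countSubsets (λ S → sizedSubsetOf X 0 S ∧ lookup S z) ≡ 0
  countSubsets-through-zero = +-cancelʳ-≡ 1 _ 0
    (trans (cong (countSubsets (λ S → sizedSubsetOf X 0 S ∧ lookup S z) +_) (sym (nC0≡1 ∣ X - z ∣)))
           (trans (countSubsets-through 0) (nC0≡1 (suc ∣ X - z ∣))))

  countSubsets-through-suc : (k : ℕ) →
    countSubsets (λ S → sizedSubsetOf X (suc k) S ∧ lookup S z) ≡ ∣ X - z ∣ C k
  countSubsets-through-suc k = +-cancelʳ-≡ (∣ X - z ∣ C suc k) _ _
    (trans (countSubsets-through (suc k)) (sym (nCk+nC[k+1]≡[n+1]C[k+1] ∣ X - z ∣ k)))

countSubsets-through-mono : {X Y : Subset n} {z w : Fin n} → z ∈ X → w ∈ Y →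
  ∣ X - z ∣ ≤ ∣ Y - w ∣ → (k : ℕ) →
  countSubsets (λ S → sizedSubsetOf X k S ∧ lookup S z) ≤
  countSubsets (λ S → sizedSubsetOf Y k S ∧ lookup S w)
countSubsets-through-mono z∈X w∈Y _ zero =
  subst (_≤ _) (sym (countSubsets-through-zero z∈X)) z≤n
countSubsets-through-mono z∈X w∈Y ∣X-z∣≤∣Y-w∣ (suc k) =
  subst₂ _≤_ (sym (countSubsets-through-suc z∈X k)) (sym (countSubsets-through-suc w∈Y k))
    (C-monoˡ-≤ k ∣X-z∣≤∣Y-w∣)

-- Cliques and edge deletion

IsSymmetric : Graph n → Set
IsSymmetric G = ∀ {i j} → T (G i j) → T (G j i)

IsLoopless : Graph n → Set
IsLoopless G = ∀ {i} → ¬ T (G i i)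

IsClique : Graph n → Subset n → Set
IsClique G S = ∀ {i j} → i ∈ S → j ∈ S → i ≢ j → T (G i j)

T-isClique⇔ : {G : Graph n} {S : Subset n} → T (isClique G S) ⇔ IsClique G S
T-isClique⇔ {n} {G} {S} = mk⇔
  (λ t {i} {j} i∈S j∈S i≢j →
     to (pair⇔ i j)
        (to (T-allᵇ⇔ (pair i) (allFin n)) (to (T-allᵇ⇔ row (allFin n)) t (∈-allFin i)) (∈-allFin j))
        (from T-lookup⇔∈ i∈S) (from T-lookup⇔∈ j∈S) (i≢j ∘ to T-==⇔))
  (λ clique → from (T-allᵇ⇔ row (allFin n)) λ {i} _ → from (T-allᵇ⇔ (pair i) (allFin n)) λ {j} _ →
     from (pair⇔ i j) λ i∈S j∈S i≢j →
       clique (to T-lookup⇔∈ i∈S) (to T-lookup⇔∈ j∈S) (i≢j ∘ from T-==⇔))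
  where
  pair : Fin n → Fin n → Bool
  pair i j = not (lookup S i ∧ lookup S j ∧ not (i == j)) ∨ G i j
  row : Fin n → Bool
  row i = allᵇ (pair i) (allFin n)
  pair⇔ : ∀ i j → T (pair i j) ⇔ (T (lookup S i) → T (lookup S j) → ¬ T (i == j) → T (G i j))
  pair⇔ i j with lookup S i | lookup S j | i == j
  ... | false | _     | _     = mk⇔ (λ _ ()) (λ _ → _)
  ... | true  | false | _     = mk⇔ (λ _ _ ()) (λ _ → _)
  ... | true  | true  | true  = mk⇔ (λ _ _ _ ¬t → ⊥-elim (¬t _)) (λ _ → _)
  ... | true  | true  | false = mk⇔ (λ g _ _ _ → g) (λ h → h _ _ id)

isCliqueOfSize : ℕ → Graph n → Subset n → Bool
isCliqueOfSize ℓ G S = (∣ S ∣ ≡ᵇ ℓ) ∧ isClique G S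

T-isCliqueOfSize⇔ : (ℓ : ℕ) (G : Graph n) (S : Subset n) →
  T (isCliqueOfSize ℓ G S) ⇔ (∣ S ∣ ≡ ℓ × IsClique G S)
T-isCliqueOfSize⇔ ℓ G S = (T-≡ᵇ⇔ ×-⇔ T-isClique⇔) ⇔-∘ T-∧

module _ (G : Graph n) (v : Fin n) (W : Subset n) {i j : Fin n} where

  delAt⁻ : T (delAt G v W i j) → T (G i j)
  delAt⁻ = proj₁ ∘ to T-∧

  delAt⁺ : T (G i j) → (i ≡ v → j ∉ W) → (j ≡ v → i ∉ W) → T (delAt G v W i j)
  delAt⁺ g i≡v⇒j∉W j≡v⇒i∉W = from T-∧ (g , from T-not⇔¬T deleted⇒⊥)
    where
    deleted⇒⊥ : ¬ T ((i == v) ∧ lookup W j ∨ (j == v) ∧ lookup W i)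
    deleted⇒⊥ t with to T-∨ t
    ... | inj₁ t′ = let (i≡v , j∈W) = to T-∧ t′ in i≡v⇒j∉W (to T-==⇔ i≡v) (to T-lookup⇔∈ j∈W)
    ... | inj₂ t′ = let (j≡v , i∈W) = to T-∧ t′ in j≡v⇒i∉W (to T-==⇔ j≡v) (to T-lookup⇔∈ i∈W)

delAt-at⁻ : (G : Graph n) (v : Fin n) (W : Subset n) {j : Fin n} → T (delAt G v W v j) → j ∉ W
delAt-at⁻ G v W {j} t j∈W = to T-not⇔¬T (proj₂ (to (T-∧ {G v j}) t))
  (from (T-∨ {(v == v) ∧ lookup W j}) (inj₁ (from T-∧ (from T-==⇔ refl , from T-lookup⇔∈ j∈W))))

∣nbhd-delAt∣+∣W∣≤∣nbhd∣ : (G : Graph n) (v : Fin n) {W : Subset n} → W ⊆ nbhd G v →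
  ∣ nbhd (delAt G v W) v ∣ + ∣ W ∣ ≤ ∣ nbhd G v ∣
∣nbhd-delAt∣+∣W∣≤∣nbhd∣ G v {W} W⊆Nv =
  ≤-trans (+-monoˡ-≤ ∣ W ∣ (p⊆q⇒∣p∣≤∣q∣ surviving⊆Nv─W)) (q⊆p⇒∣p─q∣+∣q∣≤∣p∣ W⊆Nv)
  where
  surviving⊆Nv─W : nbhd (delAt G v W) v ⊆ nbhd G v ─ W
  surviving⊆Nv─W {x} x∈ = x∈p∧x∉q⇒x∈p─q (from ∈-tabulate⇔ (delAt⁻ G v W vx)) (delAt-at⁻ G v W vx)
    where
    vx : T (delAt G v W v x)
    vx = to ∈-tabulate⇔ x∈

∣nbhd-delAt∣≤ : (G : Graph n) → IsLoopless G → {v : Fin n} {P W : Subset n} {d : ℕ} →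
  v ∈ P → nbhd G v ⊆ P → W ⊆ nbhd G v → ∣ W ∣ ≡ ∣ P ∣ ∸ 1 ∸ d → ∣ nbhd (delAt G v W) v ∣ ≤ d
∣nbhd-delAt∣≤ G G-loopless {v} {P} {W} {d} v∈P Nv⊆P W⊆Nv ∣W∣≡∣P∣∸1∸d =
  m+[n∸o]≤n⇒m≤o _ (∣ P ∣ ∸ 1) d (begin
    ∣ nbhd (delAt G v W) v ∣ + (∣ P ∣ ∸ 1 ∸ d)
      ≡⟨ cong (∣ nbhd (delAt G v W) v ∣ +_) ∣W∣≡∣P∣∸1∸d ⟨
    ∣ nbhd (delAt G v W) v ∣ + ∣ W ∣
      ≤⟨ ∣nbhd-delAt∣+∣W∣≤∣nbhd∣ G v W⊆Nv ⟩
    ∣ nbhd G v ∣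
      ≤⟨ m+n≤o⇒m≤o∸n _ (subst (_≤ ∣ P ∣) (+-comm 1 _) ∣Nv∣<∣P∣) ⟩
    ∣ P ∣ ∸ 1 ∎)
  where
  open ≤-Reasoning
  Nv⊆P-v : nbhd G v ⊆ P - v
  Nv⊆P-v k∈Nv = x∈p∧x≢y⇒x∈p-y (Nv⊆P k∈Nv) (λ { refl → G-loopless (to ∈-tabulate⇔ k∈Nv) })
  ∣Nv∣<∣P∣ : ∣ nbhd G v ∣ < ∣ P ∣
  ∣Nv∣<∣P∣ = ≤-<-trans (p⊆q⇒∣p∣≤∣q∣ Nv⊆P-v) (x∈p⇒∣p-x∣<∣p∣ v∈P)

IsClique-⊆ : {G : Graph n} {S X : Subset n} → S ⊆ X → IsClique G X → IsClique G S
IsClique-⊆ S⊆X X-clique i∈S j∈S = X-clique (S⊆X i∈S) (S⊆X j∈S)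

IsClique⇒⊆⁅v⁆∪nbhd : {G : Graph n} {S : Subset n} {v : Fin n} → IsClique G S → v ∈ S →
  S ⊆ ⁅ v ⁆ ∪ nbhd G v
IsClique⇒⊆⁅v⁆∪nbhd {v = v} S-clique v∈S {x} x∈S with x ≟ v
... | yes refl = x∈p∪q⁺ (inj₁ (x∈⁅x⁆ v))
... | no x≢v   = x∈p∪q⁺ (inj₂ (from ∈-tabulate⇔ (S-clique v∈S x∈S (x≢v ∘ sym))))

IsClique-relabel : {G H : Graph n} (π : Permutation′ n) {S : Subset n} →
  (∀ {i j} → i ∈ S → j ∈ S → T (G i j) → T (H (π ⟨$⟩ʳ i) (π ⟨$⟩ʳ j))) →
  IsClique G S → IsClique H (relabel π S)
IsClique-relabel {H = H} π {S} π-hom S-clique {i} {j} i∈πS j∈πS i≢j =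
  subst₂ (λ a b → T (H a b)) (inverseʳ π) (inverseʳ π)
    (π-hom π⁻¹i∈S π⁻¹j∈S (S-clique π⁻¹i∈S π⁻¹j∈S (i≢j ∘ ⟨$⟩ʳ-injective (Perm.flip π))))
  where
  π⁻¹i∈S : π ⟨$⟩ˡ i ∈ S
  π⁻¹i∈S = to (∈-relabel⇔ π) i∈πS
  π⁻¹j∈S : π ⟨$⟩ˡ j ∈ S
  π⁻¹j∈S = to (∈-relabel⇔ π) j∈πS

IsClique-cone : {G : Graph n} → IsSymmetric G → IsLoopless G → {u : Fin n} {A : Subset n}
  (U : Subset n) → A ⊆ nbhd G u → IsClique G A → IsClique (delAt G u U) (⁅ u ⁆ ∪ (A ─ U))
IsClique-cone {G = G} G-sym G-loopless {u} {A} U A⊆Nu A-clique {i} {j} i∈ j∈ i≢j =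
  delAt⁺ G u U (edge (i ≟ u) (j ≟ u))
    (λ i≡u → ∉U j∈ (λ j≡u → i≢j (trans i≡u (sym j≡u))))
    (λ j≡u → ∉U i∈ (λ i≡u → i≢j (trans i≡u (sym j≡u))))
  where
  ∈A─U : ∀ {x} → x ∈ ⁅ u ⁆ ∪ (A ─ U) → x ≢ u → x ∈ A ─ U
  ∈A─U x∈ x≢u with x∈p∪q⁻ ⁅ u ⁆ (A ─ U) x∈
  ... | inj₁ x∈⁅u⁆ = ⊥-elim (x≢u (x∈⁅y⁆⇒x≡y u x∈⁅u⁆))
  ... | inj₂ x∈A─U = x∈A─U
  ∉U : ∀ {x} → x ∈ ⁅ u ⁆ ∪ (A ─ U) → x ≢ u → x ∉ U
  ∉U x∈ x≢u = x∈p─q⇒x∉q (∈A─U x∈ x≢u)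
  ∈A : ∀ {x} → x ∈ ⁅ u ⁆ ∪ (A ─ U) → x ≢ u → x ∈ A
  ∈A x∈ x≢u = p─q⊆p A U (∈A─U x∈ x≢u)
  u∼ : ∀ {x} → x ∈ ⁅ u ⁆ ∪ (A ─ U) → x ≢ u → T (G u x)
  u∼ x∈ x≢u = to ∈-tabulate⇔ (A⊆Nu (∈A x∈ x≢u))
  edge : Dec (i ≡ u) → Dec (j ≡ u) → T (G i j)
  edge (yes i≡u) (yes j≡u) = ⊥-elim (i≢j (trans i≡u (sym j≡u)))
  edge (yes i≡u) (no j≢u)  = subst (λ a → T (G a j)) (sym i≡u) (u∼ j∈ j≢u)
  edge (no i≢u)  (yes j≡u) = subst (λ b → T (G i b)) (sym j≡u) (G-sym (u∼ i∈ i≢u))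
  edge (no i≢u)  (no j≢u)  = A-clique (∈A i∈ i≢u) (∈A j∈ j≢u) i≢j

NK-avoiding-≤ : (ℓ : ℕ) (G : Graph n) {u v : Fin n} (U W : Subset n) (π : Permutation′ n) →
  π ⟨$⟩ʳ v ≡ u → (∀ {i j} → i ≢ v → j ≢ v → T (G i j) → T (G (π ⟨$⟩ʳ i) (π ⟨$⟩ʳ j))) →
  countSubsets (λ S → isCliqueOfSize ℓ (delAt G v W) S ∧ not (lookup S v)) ≤
  countSubsets (λ S → isCliqueOfSize ℓ (delAt G u U) S ∧ not (lookup S u))
NK-avoiding-≤ ℓ G {u} {v} U W π πv≡u π-hom =
  countSubsets-injection (relabel π) (relabel-injective π) relabelled
  where
  π⁻¹u≡v : π ⟨$⟩ˡ u ≡ v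
  π⁻¹u≡v = trans (cong (π ⟨$⟩ˡ_) (sym πv≡u)) (inverseˡ π)
  relabelled : ∀ S → T (isCliqueOfSize ℓ (delAt G v W) S ∧ not (lookup S v)) →
    T (isCliqueOfSize ℓ (delAt G u U) (relabel π S) ∧ not (lookup (relabel π S) u))
  relabelled S t with to T-∧ t
  ... | t₁ , v∉S′ with to (T-isCliqueOfSize⇔ ℓ (delAt G v W) S) t₁
  ... | ∣S∣≡ℓ , S-clique = from T-∧
    ( from (T-isCliqueOfSize⇔ ℓ (delAt G u U) (relabel π S))
        (trans (∣relabel∣ π S) ∣S∣≡ℓ , IsClique-relabel π edge S-clique)
    , from T-not⇔¬T (u∉πS ∘ to T-lookup⇔∈))
    where
    v∉S : v ∉ S
    v∉S = to T-not⇔¬T v∉S′ ∘ from T-lookup⇔∈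
    u∉πS : u ∉ relabel π S
    u∉πS u∈πS = v∉S (subst (_∈ S) π⁻¹u≡v (to (∈-relabel⇔ π) u∈πS))
    ≢v : ∀ {i} → i ∈ S → i ≢ v
    ≢v i∈S refl = v∉S i∈S
    πi≢u : ∀ {i} → i ∈ S → π ⟨$⟩ʳ i ≢ u
    πi≢u i∈S πi≡u = ≢v i∈S (trans (sym (inverseˡ π)) (trans (cong (π ⟨$⟩ˡ_) πi≡u) π⁻¹u≡v))
    edge : ∀ {i j} → i ∈ S → j ∈ S → T (delAt G v W i j) → T (delAt G u U (π ⟨$⟩ʳ i) (π ⟨$⟩ʳ j))
    edge i∈S j∈S ij = delAt⁺ G u U (π-hom (≢v i∈S) (≢v j∈S) (delAt⁻ G v W ij))
      (⊥-elim ∘ πi≢u i∈S) (⊥-elim ∘ πi≢u j∈S)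

NK-through-≤ : (ℓ : ℕ) (G : Graph n) → IsSymmetric G → IsLoopless G →
  {u v : Fin n} (U W A : Subset n) → A ⊆ nbhd G u → IsClique G A →
  ∣ nbhd (delAt G v W) v ∣ ≤ ∣ A ─ U ∣ →
  countSubsets (λ S → isCliqueOfSize ℓ (delAt G v W) S ∧ lookup S v) ≤
  countSubsets (λ S → isCliqueOfSize ℓ (delAt G u U) S ∧ lookup S u)
NK-through-≤ ℓ G G-sym G-loopless {u} {v} U W A A⊆Nu A-clique ∣Nv∣≤∣A─U∣ = begin
  countSubsets (λ S → isCliqueOfSize ℓ G₁ S ∧ lookup S v)  ≤⟨ countSubsets-mono inX₁ ⟩
  countSubsets (λ S → sizedSubsetOf X₁ ℓ S ∧ lookup S v)   ≤⟨ countSubsets-through-mono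
                                                                v∈X₁ u∈X₂ ∣X₁-v∣≤∣X₂-u∣ ℓ ⟩
  countSubsets (λ S → sizedSubsetOf X₂ ℓ S ∧ lookup S u)   ≤⟨ countSubsets-mono fromX₂ ⟩
  countSubsets (λ S → isCliqueOfSize ℓ G₂ S ∧ lookup S u)  ∎
  where
  open ≤-Reasoning
  G₁ G₂ : Graph _
  G₁ = delAt G v W
  G₂ = delAt G u U
  X₁ X₂ : Subset _
  X₁ = ⁅ v ⁆ ∪ nbhd G₁ v
  X₂ = ⁅ u ⁆ ∪ (A ─ U)
  v∈X₁ : v ∈ X₁
  v∈X₁ = x∈p∪q⁺ (inj₁ (x∈⁅x⁆ v))
  u∈X₂ : u ∈ X₂
  u∈X₂ = x∈p∪q⁺ (inj₁ (x∈⁅x⁆ u))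
  u∉A─U : u ∉ A ─ U
  u∉A─U u∈ = G-loopless (to ∈-tabulate⇔ (A⊆Nu (p─q⊆p A U u∈)))
  ∣X₁-v∣≤∣X₂-u∣ : ∣ X₁ - v ∣ ≤ ∣ X₂ - u ∣
  ∣X₁-v∣≤∣X₂-u∣ = ≤-trans (p⊆q⇒∣p∣≤∣q∣ ([⁅x⁆∪p]-x⊆p {x = v} {nbhd G₁ v}))
    (≤-trans ∣Nv∣≤∣A─U∣ (p⊆q⇒∣p∣≤∣q∣ (x∉p⇒p⊆[⁅x⁆∪p]-x u∉A─U)))
  inX₁ : ∀ S → T (isCliqueOfSize ℓ G₁ S ∧ lookup S v) → T (sizedSubsetOf X₁ ℓ S ∧ lookup S v)
  inX₁ S t =
    let (t₁ , v∈S) = to T-∧ t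
        (∣S∣≡ℓ , S-clique) = to (T-isCliqueOfSize⇔ ℓ G₁ S) t₁
    in from T-∧ (from (T-sizedSubsetOf⇔ X₁ ℓ S)
                  (IsClique⇒⊆⁅v⁆∪nbhd S-clique (to T-lookup⇔∈ v∈S) , ∣S∣≡ℓ) , v∈S)
  fromX₂ : ∀ S → T (sizedSubsetOf X₂ ℓ S ∧ lookup S u) → T (isCliqueOfSize ℓ G₂ S ∧ lookup S u)
  fromX₂ S t =
    let (t₁ , u∈S) = to T-∧ t
        (S⊆X₂ , ∣S∣≡ℓ) = to (T-sizedSubsetOf⇔ X₂ ℓ S) t₁
    in from T-∧ (from (T-isCliqueOfSize⇔ ℓ G₂ S)
                  (∣S∣≡ℓ , IsClique-⊆ S⊆X₂ (IsClique-cone G-sym G-loopless U A⊆Nu A-clique)) , u∈S)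

transpose-homomorphism : (G : Graph n) → IsSymmetric G → IsLoopless G →
  {u v : Fin n} → (∀ {k} → k ≢ v → T (G u k) → T (G v k)) →
  ∀ {i j} → i ≢ v → j ≢ v → T (G i j) →
  T (G (Perm.transpose u v ⟨$⟩ʳ i) (Perm.transpose u v ⟨$⟩ʳ j))
transpose-homomorphism G G-sym G-loopless {u} {v} Nu⊆Nv {i} {j} i≢v j≢v ij = edge (i ≟ u) (j ≟ u)
  where
  image : ∀ {k} → k ≢ u → k ≢ v → Perm.transpose u v ⟨$⟩ʳ k ≡ k
  image k≢u k≢v = transpose-other u v k≢u k≢v
  edge : Dec (i ≡ u) → Dec (j ≡ u) →
    T (G (Perm.transpose u v ⟨$⟩ʳ i) (Perm.transpose u v ⟨$⟩ʳ j))
  edge (yes refl) (yes refl) = ⊥-elim (G-loopless ij)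
  edge (yes refl) (no j≢u)   = subst₂ (λ a b → T (G a b))
    (sym (transpose-matchˡ u v)) (sym (image j≢u j≢v)) (Nu⊆Nv j≢v ij)
  edge (no i≢u)   (yes refl) = subst₂ (λ a b → T (G a b))
    (sym (image i≢u i≢v)) (sym (transpose-matchˡ u v)) (G-sym (Nu⊆Nv i≢v (G-sym ij)))
  edge (no i≢u)   (no j≢u)   = subst₂ (λ a b → T (G a b))
    (sym (image i≢u i≢v)) (sym (image j≢u j≢v)) ij

NK-delAt-≤ : (ℓ : ℕ) (G : Graph n) → IsSymmetric G → IsLoopless G →
  {u v : Fin n} → (∀ {k} → k ≢ v → T (G u k) → T (G v k)) →
  (U W A : Subset n) → A ⊆ nbhd G u → IsClique G A → ∣ nbhd (delAt G v W) v ∣ ≤ ∣ A ─ U ∣ →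
  NK ℓ (delAt G v W) ≤ NK ℓ (delAt G u U)
NK-delAt-≤ ℓ G G-sym G-loopless {u} {v} Nu⊆Nv U W A A⊆Nu A-clique ∣Nv∣≤∣A─U∣ = begin
  NK ℓ (delAt G v W)
    ≡⟨ countSubsets-partition (isCliqueOfSize ℓ (delAt G v W)) (λ S → lookup S v) ⟩
  countSubsets (λ S → isCliqueOfSize ℓ (delAt G v W) S ∧ lookup S v) +
  countSubsets (λ S → isCliqueOfSize ℓ (delAt G v W) S ∧ not (lookup S v))
    ≤⟨ +-mono-≤ (NK-through-≤ ℓ G G-sym G-loopless U W A A⊆Nu A-clique ∣Nv∣≤∣A─U∣)
                (NK-avoiding-≤ ℓ G U W (Perm.transpose u v) (transpose-matchʳ u v)
                  (transpose-homomorphism G G-sym G-loopless Nu⊆Nv)) ⟩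
  countSubsets (λ S → isCliqueOfSize ℓ (delAt G u U) S ∧ lookup S u) +
  countSubsets (λ S → isCliqueOfSize ℓ (delAt G u U) S ∧ not (lookup S u))
    ≡⟨ countSubsets-partition (isCliqueOfSize ℓ (delAt G u U)) (λ S → lookup S u) ⟨
  NK ℓ (delAt G u U) ∎
  where open ≤-Reasoning

-- The graph J_t

2*t≤m⇒t≤m∸t : ∀ {m t} → 2 * t ≤ m → t ≤ m ∸ t
2*t≤m⇒t≤m∸t {m} {t} 2t≤m = m+n≤o⇒m≤o∸n t (subst (_≤ m) (cong (t +_) (+-identityʳ t)) 2t≤m)

module J-properties (m t : ℕ) where

  T-J⇔ : {i j : Fin n} → T (J m t i j) ⇔
    (i ≢ j × (toℕ i < t ⊎ toℕ j < t ⊎ (toℕ i < m ∸ t × toℕ j < m ∸ t)))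
  T-J⇔ {i = i} {j} =
    ((¬T-==⇔ ⇔-∘ T-not⇔¬T) ×-⇔
     ((T-<ᵇ⇔ ⊎-⇔ ((T-<ᵇ⇔ ⊎-⇔ ((T-<ᵇ⇔ ×-⇔ T-<ᵇ⇔) ⇔-∘ T-∧)) ⇔-∘ T-∨)) ⇔-∘ T-∨)) ⇔-∘ T-∧
    where
    ¬T-==⇔ : (¬ T (i == j)) ⇔ i ≢ j
    ¬T-==⇔ = mk⇔ (λ ¬t → ¬t ∘ from T-==⇔) (λ i≢j → i≢j ∘ to T-==⇔)

  J-sym : IsSymmetric {n} (J m t)
  J-sym ij with to T-J⇔ ij
  ... | i≢j , adjacency = from T-J⇔ (i≢j ∘ sym , swap adjacency)
    where
    swap : ∀ {a b} → a < t ⊎ b < t ⊎ (a < m ∸ t × b < m ∸ t) →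
                     b < t ⊎ a < t ⊎ (b < m ∸ t × a < m ∸ t)
    swap (inj₁ a<t)              = inj₂ (inj₁ a<t)
    swap (inj₂ (inj₁ b<t))       = inj₁ b<t
    swap (inj₂ (inj₂ (a< , b<))) = inj₂ (inj₂ (b< , a<))

  J-loopless : IsLoopless {n} (J m t)
  J-loopless ii = proj₁ (to T-J⇔ ii) refl

  J-adjacent-Kt : {i j : Fin n} → i ≢ j → toℕ j < t → T (J m t i j)
  J-adjacent-Kt i≢j j<t = from T-J⇔ (i≢j , inj₂ (inj₁ j<t))

  J-nbhd-indep : {u k : Fin n} → t ≤ m ∸ t → InIndep m t u → T (J m t u k) → toℕ k < t
  J-nbhd-indep t≤m∸t m∸t≤u uk with proj₂ (to T-J⇔ uk)
  ... | inj₁ u<t             = ⊥-elim (<⇒≱ u<t (≤-trans t≤m∸t m∸t≤u))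
  ... | inj₂ (inj₁ k<t)      = k<t
  ... | inj₂ (inj₂ (u< , _)) = ⊥-elim (<⇒≱ u< m∸t≤u)

  J-nbhd-mid : {v k : Fin n} → t ≤ m ∸ t → t ≤ toℕ v → T (J m t v k) → toℕ k < m ∸ t
  J-nbhd-mid t≤m∸t t≤v vk with proj₂ (to T-J⇔ vk)
  ... | inj₁ v<t             = ⊥-elim (<⇒≱ v<t t≤v)
  ... | inj₂ (inj₁ k<t)      = <-≤-trans k<t t≤m∸t
  ... | inj₂ (inj₂ (_ , k<)) = k<

-- b is 2s − t when v ∈ K_{2s−2t}, and n when v ∈ K_t.
NK-delAt-J-≤ : (ℓ : ℕ) {m t δ b : ℕ} → δ ≤ t → t ≤ m ∸ t → t ≤ n → b ≤ n →
  (u : Fin n) → InIndep m t u → (U : Subset n) → ∣ U ∣ ≡ t ∸ δ →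
  (v : Fin n) → toℕ v < b → (∀ {k} → T (J m t v k) → toℕ k < b) →
  (W : Subset n) → W ⊆ nbhd (J m t) v → ∣ W ∣ ≡ b ∸ 1 ∸ δ →
  NK ℓ (delAt (J m t) v W) ≤ NK ℓ (delAt (J m t) u U)
NK-delAt-J-≤ ℓ {m} {t} {δ} {b} δ≤t t≤m∸t t≤n b≤n u u-indep U ∣U∣≡t∸δ v v<b Nv<b W W⊆Nv ∣W∣≡b∸1∸δ =
  NK-delAt-≤ ℓ (J m t) J-sym J-loopless Nu⊆Nv U W (below t) Kt⊆Nu Kt-clique
    (≤-trans ∣N′v∣≤δ δ≤∣Kt─U∣)
  where
  open J-properties m t
  Nu⊆Nv : ∀ {k} → k ≢ v → T (J m t u k) → T (J m t v k)
  Nu⊆Nv k≢v uk = J-adjacent-Kt (k≢v ∘ sym) (J-nbhd-indep t≤m∸t u-indep uk)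
  Kt⊆Nu : below t ⊆ nbhd (J m t) u
  Kt⊆Nu {k} k∈Kt = from ∈-tabulate⇔ (J-adjacent-Kt u≢k k<t)
    where
    k<t : toℕ k < t
    k<t = to ∈-below⇔ k∈Kt
    u≢k : u ≢ k
    u≢k refl = <⇒≱ k<t (≤-trans t≤m∸t u-indep)
  Kt-clique : IsClique (J m t) (below t)
  Kt-clique _ j∈Kt i≢j = J-adjacent-Kt i≢j (to ∈-below⇔ j∈Kt)
  δ≤∣Kt─U∣ : δ ≤ ∣ below t ─ U ∣
  δ≤∣Kt─U∣ = ∣q∣≡∣p∣∸d⇒d≤∣p─q∣ {p = below t} {U} (subst (δ ≤_) (sym (∣below∣ t≤n)) δ≤t)
    (subst (λ c → ∣ U ∣ ≡ c ∸ δ) (sym (∣below∣ t≤n)) ∣U∣≡t∸δ)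
  ∣N′v∣≤δ : ∣ nbhd (delAt (J m t) v W) v ∣ ≤ δ
  ∣N′v∣≤δ = ∣nbhd-delAt∣≤ (J m t) J-loopless (from ∈-below⇔ v<b)
    (λ k∈Nv → from ∈-below⇔ (Nv<b (to ∈-tabulate⇔ k∈Nv)))
    W⊆Nv (subst (λ c → ∣ W ∣ ≡ c ∸ 1 ∸ δ) (sym (∣below∣ b≤n)) ∣W∣≡b∸1∸δ)

lemma2p2 : (n m ℓ δ : ℕ) → 1 ≤ m → m + 1 ≤ n → 5 ≤ m + 1 → 2 ≤ ℓ → 1 ≤ δ →
    ((t : ℕ) → δ ≤ t → 2 * t + 2 ≤ m →
      (u : Fin n) → InIndep m t u → (U : Subset n) → U ⊆ nbhd (J m t) u → ∣ U ∣ ≡ t ∸ δ →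
      (v : Fin n) → InKmid m t v → (W : Subset n) → W ⊆ nbhd (J m t) v →
      ∣ W ∣ ≡ m ∸ t ∸ 1 ∸ δ →
      NK ℓ (delAt (J m t) v W) ≤ NK ℓ (delAt (J m t) u U))
    ×
    ((t : ℕ) → δ ≤ t → 2 * t ≤ m →
      (u : Fin n) → InIndep m t u → (U : Subset n) → U ⊆ nbhd (J m t) u → ∣ U ∣ ≡ t ∸ δ →
      (v : Fin n) → InKt t v → (W : Subset n) → W ⊆ nbhd (J m t) v →
      ∣ W ∣ ≡ n ∸ 1 ∸ δ →
      NK ℓ (delAt (J m t) v W) ≤ NK ℓ (delAt (J m t) u U))
lemma2p2 n m ℓ δ _ m+1≤n _ _ _ =
  (λ t δ≤t 2t+2≤m u u-indep U _ ∣U∣ v (t≤v , v<m∸t) W W⊆Nv ∣W∣ →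
    let t≤m∸t : t ≤ m ∸ t
        t≤m∸t = 2*t≤m⇒t≤m∸t (≤-trans (m≤m+n (2 * t) 2) 2t+2≤m)
    in NK-delAt-J-≤ ℓ δ≤t t≤m∸t (t≤n t≤m∸t) (m∸t≤n t) u u-indep U ∣U∣
         v v<m∸t (J-properties.J-nbhd-mid m t t≤m∸t t≤v) W W⊆Nv ∣W∣)
  ,
  (λ t δ≤t 2t≤m u u-indep U _ ∣U∣ v _ W W⊆Nv ∣W∣ →
    let t≤m∸t : t ≤ m ∸ t
        t≤m∸t = 2*t≤m⇒t≤m∸t 2t≤m
    in NK-delAt-J-≤ ℓ δ≤t t≤m∸t (t≤n t≤m∸t) ≤-refl u u-indep U ∣U∣
         v (toℕ<n v) (λ {k} _ → toℕ<n k) W W⊆Nv ∣W∣)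
  where
  m∸t≤n : ∀ t → m ∸ t ≤ n
  m∸t≤n t = ≤-trans (m∸n≤m m t) (≤-trans (m≤m+n m 1) m+1≤n)
  t≤n : ∀ {t} → t ≤ m ∸ t → t ≤ n
  t≤n {t} t≤m∸t = ≤-trans t≤m∸t (m∸t≤n t)
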